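{- Let $\mathbb{G}=(V,E)$ be a ribbon graph. Then the set $\mathcal{B}(\mathbb{G}):= \{ T(X,Y,Z) : (X,Y,Z)\in \mathcal{Q}(\mathbb{G}) \}$ is the collection of bases of a tight $3$-matroid with carrier $(U(\mathbb{G}),\Omega)$.
   Context: A ribbon graph $\mathbb G=(V,E)$ is a surface with boundary given as a union of discs, vertices $V$ and edges $E$, such that vertices and edges meet in disjoint line segments, each on the boundary of exactly one vertex and one edge, and each edge contains exactly two such segments. $b(\cdot)$ counts boundary components, $k(\cdot)$ connected components; $\mathbb G\setminus Y$ deletes the edges in $Y$; the partial Petrial $\mathbb G^{\tau(Z)}$ is obtained by, for each $e\in Z$, detaching one end of $e$ and reattaching it with a half-twist. $\mathcal P_3(E)$ is the set of ordered partitions of $E$ into three possibly empty blocks, and $\mathcal Q(\mathbb G)=\{(X,Y,Z)\in\mathcal P_3(E): b(\mathbb G^{\tau(Z)}\setminus Y)=k(\mathbb G)\}$. $U(\mathbb G)=\{\dot e,\bar e,\hat e: e\in E\}$, $\Omega=\{\omega_e: e\in E\}$ with $\omega_e=\{\dot e,\bar e,\hat e\}$, and $T(X,Y,Z)=\{\dot e:e\in X\}\cup\{\bar e:e\in Y\}\cup\{\hat e: e\in Z\}$. A multimatroid on carrier $(U,\Omega)$ ($\Omega$ a partition of finite $U$ into skew classes) is given by a non-negative integer function $r$ on subtransversals (sets meeting each skew class at most once) such that $r$ on each transversal is a matroid rank function and $r(S\cup\{x\})+r(S\cup\{y\})-2r(S)\ge1$ for any subtransversal $S$ and distinct $x,y$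 in a skew class disjoint from $S$; bases are maximal subtransversals with $r(S)=|S|$, and a multimatroid is determined by its bases. A $3$-matroid is one whose skew classes all have size 3. A multimatroid is tight if every skew class has size at least 2 and for every subtransversal $S$ missing exactly one skew class $\omega$ there is $x\in\omega$ with $r(S\cup\{x\})=r(S)$. -}

module Defs where

open import Data.Nat using (ℕ; zero; suc; _+_; _*_; _≤_)
open import Data.Bool using (Bool; true; false; if_then_else_; _xor_)
open import Data.Fin using (Fin; zero; suc; _≟_)
open import Data.Fin.Subset using (Subset; _∪_; _∩_; _⊆_; ∣_∣)
open import Data.Vec using (lookup)
open import Data.Maybe using (Maybe; just; nothing; is-just)
open import Data.Product using (Σ; _×_; _,_; ∃)
open import Function.Bundles using (_↔_; _⇔_; Inverse)
open import Relation.Nullary using (¬_; does)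
open import Relation.Binary.PropositionalEquality using (_≡_; _≢_)
open import Relation.Binary.Core using (Rel)
import Level
open import Relation.Binary.Construct.Closure.Equivalence using (EqClosure)

-- Ribbon graphs as signed rotation systems.  Darts (edge-ends): (e , i) with i : Fin 2.
-- rot : cyclic successor of a dart around its vertex (counterclockwise
-- w.r.t. the local orientation of the vertex disc); vertices carrying
-- at least one edge-end are the cycles of rot.  nIso = number of
-- vertices with no incident edge.  twist e = true iff edge e is
-- twisted relative to the local orientations of its end vertices.

Dart : ℕ → Set
Dart ne = Fin ne × Fin 2

record RibbonGraph : Set where
  field
    ne   : ℕ
    nIso : ℕ
    rot  : Dart ne ↔ Dart ne
    twist : Fin ne → Bool

open RibbonGraph public

σ : (G : RibbonGraph) → Dart (ne G) → Dart (ne G)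
σ G = Inverse.to (rot G)

petrial : (G : RibbonGraph) → (Fin (ne G) → Bool) → RibbonGraph
petrial G Z = record G { twist = λ e → twist G e xor Z e }

HasComponents : {A : Set} → Rel A _ → ℕ → Set
HasComponents {A} R c =
  Σ (A → Fin c) λ f →
    (∀ (i : Fin c) → ∃ λ x → f x ≡ i) ×
    (∀ x y → (f x ≡ f y) ⇔ EqClosure R x y)

-- Boundary points: two per dart, (d , s), s = 0 the
-- clockwise side, s = 1 the counterclockwise side of the attaching segment.
-- Boundary arcs: vertex arcs from (d,1) to (rot d, 0); for kept edges the
-- two sides of the edge ribbon; for a deleted edge its attaching segments
-- become part of the vertex boundary, joining (d,0) and (d,1).

BPoint : ℕ → Set
BPoint ne = Dart ne × Fin 2

flip2 : Fin 2 → Fin 2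
flip2 zero = suc zero
flip2 (suc _) = zero

data BArc (G : RibbonGraph) (Y : Fin (ne G) → Bool) : Rel (BPoint (ne G)) Level.zero where
  varc : ∀ d → BArc G Y (d , suc zero) (σ G d , zero)
  untw : ∀ e → Y e ≡ false → twist G e ≡ false → ∀ s →
         BArc G Y ((e , zero) , s) ((e , suc zero) , flip2 s)
  tw   : ∀ e → Y e ≡ false → twist G e ≡ true → ∀ s →
         BArc G Y ((e , zero) , s) ((e , suc zero) , s)
  del  : ∀ e → Y e ≡ true → ∀ i →
         BArc G Y ((e , i) , zero) ((e , i) , suc zero)

-- b(G \ Y) = c : number of boundary components (isolated vertices each
-- contribute one boundary circle).
BoundaryCount : (G : RibbonGraph) → (Fin (ne G) → Bool) → ℕ → Set
BoundaryCount G Y m = ∃ λ c → HasComponents (BArc G Y) c × m ≡ nIso G + c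

data CArc (G : RibbonGraph) : Rel (Dart (ne G)) Level.zero where
  vtx  : ∀ d → CArc G d (σ G d)
  edge : ∀ e → CArc G (e , zero) (e , suc zero)

ComponentCount : RibbonGraph → ℕ → Set
ComponentCount G m = ∃ λ c → HasComponents (CArc G) c × m ≡ nIso G + c

-- Ordered partitions (X , Y , Z) of E into three blocks are given by
-- p : Fin ne → Fin 3, with X = p⁻¹(0), Y = p⁻¹(1), Z = p⁻¹(2).

blockY : {n : ℕ} → (Fin n → Fin 3) → Fin n → Bool
blockY p e = does (p e ≟ suc zero)

blockZ : {n : ℕ} → (Fin n → Fin 3) → Fin n → Bool
blockZ p e = does (p e ≟ suc (suc zero))

InQ : (G : RibbonGraph) → (Fin (ne G) → Fin 3) → Set
InQ G p = ∃ λ m → BoundaryCount (petrial G (blockZ p)) (blockY p) m × ComponentCount G m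

-- Multimatroids on the carrier U = Fin n × Fin k with skew classes
-- ω_e = {e} × Fin k.  For n = ne G, k = 3 the element (e , 0) is ė,
-- (e , 1) is ē, (e , 2) is ê;  T(X,Y,Z) is the transversal p.
-- A subtransversal is a partial choice function.

SubTr : ℕ → ℕ → Set
SubTr n k = Fin n → Maybe (Fin k)

size : {n k : ℕ} → SubTr n k → ℕ
size {zero} S = 0
size {suc n} S = (if is-just (S zero) then 1 else 0) + size (λ e → S (suc e))

_⊆ₛ_ : {n k : ℕ} → SubTr n k → SubTr n k → Set
S ⊆ₛ S' = ∀ e x → S e ≡ just x → S' e ≡ just x

_[_↦_] : {n k : ℕ} → SubTr n k → Fin n → Fin k → SubTr n k
(S [ e ↦ x ]) e' = if does (e' ≟ e) then just x else S e'

restrict : {n k : ℕ} → (Fin n → Fin k) → Subset n → SubTr n k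
restrict t A e = if lookup A e then just (t e) else nothing

record IsMatroidRank {n : ℕ} (ρ : Subset n → ℕ) : Set where
  field
    bounded    : ∀ A → ρ A ≤ ∣ A ∣
    monotone   : ∀ A B → A ⊆ B → ρ A ≤ ρ B
    submodular : ∀ A B → ρ (A ∪ B) + ρ (A ∩ B) ≤ ρ A + ρ B

record Multimatroid (n k : ℕ) : Set where
  field
    r : SubTr n k → ℕ
    rank-on-transversals : ∀ (t : Fin n → Fin k) → IsMatroidRank (λ A → r (restrict t A))
    skew : ∀ (S : SubTr n k) e x y → S e ≡ nothing → x ≢ y →
           2 * r S + 1 ≤ r (S [ e ↦ x ]) + r (S [ e ↦ y ])

open Multimatroid public

IsBasis : {n k : ℕ} → Multimatroid n k → SubTr n k → Set
IsBasis M S = r M S ≡ size S × (∀ S' → S ⊆ₛ S' → r M S' ≡ size S' → S' ⊆ₛ S)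

Tight : {n k : ℕ} → Multimatroid n k → Set
Tight {n} {k} M =
  2 ≤ k ×
  (∀ (S : SubTr n k) e → S e ≡ nothing → (∀ e' → e' ≢ e → ¬ (S e' ≡ nothing)) →
     ∃ λ x → r M (S [ e ↦ x ]) ≡ r M S)

-- For a subtransversal S put a graph on the 4|E| corners of the edge ribbons: vertex arcs run
-- along the vertex boundaries, an edge carrying a choice joins its four corners in the two pairs
-- that the boundary of G^{τ(Z)} \ Y joins there, and an edge without a choice merges all four.
-- With c(S) its number of components and k₀ = c(∅), set r(S) = |S| + k₀ - c(S).  On a transversal
-- T(X,Y,Z), c counts the boundary components of G^{τ(Z)} \ Y other than isolated vertices, and
-- k₀ counts the components of G other than isolated vertices, so the bases are the T(X,Y,Z) with
-- (X,Y,Z) ∈ Q(G).  Submodularity of r on transversals is submodularity of component counts.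
-- Choosing x at a free edge e raises r by one exactly when the bridge joining the two pairs of
-- its matching would close a cycle.  Once every other edge is fixed, all corners except those of
-- e have degree two, so the boundary path leaving one corner of e returns at another corner of e;
-- the matching pairing these two corners is the only one whose bridge closes no cycle.  Hence at
-- most one choice fails to raise r (the skew axiom), and exactly one does (tightness).

module Submission where

open import Defs
open import Data.Bool using (Bool; true; false; if_then_else_; not; _∧_; _∨_; _xor_)
open import Data.Bool.Properties using (∨-zeroʳ)
open import Data.Empty using (⊥-elim)
open import Data.Fin using (Fin; zero; suc; _≟_; toℕ; punchOut; punchIn)
open import Data.Fin.Properties
  using (¬Fin0; *↔×; pigeonhole; toℕ<n; injective⇒≤;
         punchOut-injective; punchOut-cong; punchOut-punchIn; punchInᵢ≢i)
open import Data.Fin.Subset using (Subset; _⊆_; _∪_; _∩_; ∣_∣)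
open import Data.Fin.Subset.Properties using (drop-∷-⊆)
open import Data.List using (List; []; _∷_; _++_; [_]; concat; tabulate; length)
open import Data.List.Properties using (tabulate-cong; length-++; ++-assoc)
open import Data.List.Membership.Propositional using (_∈_)
open import Data.List.Membership.Propositional.Properties
  using (∈-++⁺ˡ; ∈-++⁺ʳ; ∈-++⁻; ∈-concat⁺′; ∈-concat⁻′; ∈-tabulate⁺; ∈-tabulate⁻)
open import Data.List.Relation.Unary.Any using (here; there)
open import Data.List.Relation.Binary.Permutation.Propositional using (_↭_; ↭-sym)
open import Data.List.Relation.Binary.Permutation.Propositional.Properties using (∈-resp-↭; shift)
open import Data.Maybe as Maybe using (Maybe; just; nothing; is-just; is-nothing; fromMaybe)
open import Data.Maybe.Properties using (just-injective)
open import Data.Nat using (ℕ; zero; suc; _+_; _*_; _∸_; _≤_; _<_; z≤n; s≤s; s≤s⁻¹)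
open import Data.Nat.Properties
  using (≤-refl; ≤-reflexive; ≤-trans; ≤-antisym; <-trans; <⇒≤; n<1+n; n≤1+n; m≤n+m; m≤m+n; m≤n⇒m<n∨m≡n;
         m≤n⇒∃[o]m+o≡n; +-suc; +-comm; +-assoc; +-identityʳ; +-mono-≤; +-monoʳ-≤; +-monoˡ-≤; +-cancelʳ-≤;
         +-cancelʳ-≡; +-cancelˡ-≡; m∸n+n≡m; m+n∸n≡m; ∸-monoʳ-≤; +-commutativeSemigroup; module ≤-Reasoning)
open import Algebra.Properties.CommutativeSemigroup +-commutativeSemigroup using (interchange; xy∙z≈xz∙y)
open import Data.Product using (Σ; _×_; _,_; ∃; proj₁; proj₂)
open import Data.Product.Function.NonDependent.Propositional using (_×-↔_)
open import Data.Sum using (_⊎_; inj₁; inj₂)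
open import Data.Vec as Vec using ([]; _∷_; lookup)
open import Data.Vec.Properties using (lookup-zipWith; []=⇒lookup; lookup⇒[]=)
open import Function using (_∘_; _↔_; _↣_; _⇔_; Inverse; Injection; Equivalence; mk⇔)
open import Function.Properties.Equivalence using (⇔-isEquivalence)
open import Function.Properties.Inverse using (↔-refl; ↔-sym; ↔-trans; ↔⇒↣)
open import Level using (0ℓ)
open import Relation.Binary.Core using (Rel; _⇒_; _=[_]⇒_)
open import Relation.Binary.Definitions using (Decidable)
open import Relation.Binary.Construct.Closure.Equivalence as EC using (EqClosure; _⋆)
open import Relation.Binary.Construct.Closure.ReflexiveTransitive using (ε; _◅◅_)
open import Relation.Binary.PropositionalEquality
  using (_≡_; _≢_; refl; sym; trans; cong; cong₂; subst; subst₂; isEquivalence; module ≡-Reasoning)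
open import Relation.Nullary using (¬_; yes; no; does; contradiction)
open import Relation.Nullary.Decidable using (dec-true; dec-false)

module _ {A : Set} where

  HasComponents-≤ : ∀ {R R′ : Rel A 0ℓ} {c c′} → HasComponents R c → HasComponents R′ c′ →
                    R′ ⇒ EqClosure R → c ≤ c′
  HasComponents-≤ {c = c} (f , f-onto , f-classes) (f′ , _ , f′-classes) R′⊆R =
    injective⇒≤ {f = f′ ∘ rep} rep-injective
    where
    rep : Fin c → A
    rep i = proj₁ (f-onto i)
    rep-injective : ∀ {i j} → f′ (rep i) ≡ f′ (rep j) → i ≡ j
    rep-injective {i} {j} eq = begin
      i         ≡⟨ sym (proj₂ (f-onto i)) ⟩
      f (rep i) ≡⟨ Equivalence.from (f-classes _ _) ((R′⊆R ⋆) (Equivalence.to (f′-classes _ _) eq)) ⟩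
      f (rep j) ≡⟨ proj₂ (f-onto j) ⟩
      j         ∎
      where open ≡-Reasoning

  HasComponents-unique : ∀ {R R′ : Rel A 0ℓ} {c c′} → HasComponents R c → HasComponents R′ c′ →
                         R ⇒ EqClosure R′ → R′ ⇒ EqClosure R → c ≡ c′
  HasComponents-unique H H′ R⊆R′ R′⊆R =
    ≤-antisym (HasComponents-≤ H H′ R′⊆R) (HasComponents-≤ H′ H R⊆R′)

  HasComponents-resp : ∀ {R R′ : Rel A 0ℓ} {c} → HasComponents R c →
                       R ⇒ EqClosure R′ → R′ ⇒ EqClosure R → HasComponents R′ c
  HasComponents-resp (f , f-onto , f-classes) R⊆R′ R′⊆R =
    f , f-onto , λ x y → mk⇔ ((R⊆R′ ⋆) ∘ Equivalence.to (f-classes x y))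
                              (Equivalence.from (f-classes x y) ∘ (R′⊆R ⋆))

module LabelFusion {c : ℕ} (i j : Fin (suc c)) (i≢j : i ≢ j) where

  redirect : Fin (suc c) → Fin (suc c)
  redirect k with k ≟ j
  ... | yes _ = i
  ... | no  _ = k

  redirect-cases : ∀ k → (k ≡ j × redirect k ≡ i) ⊎ (k ≢ j × redirect k ≡ k)
  redirect-cases k with k ≟ j
  ... | yes k≡j = inj₁ (k≡j , refl)
  ... | no  k≢j = inj₂ (k≢j , refl)

  j≢redirect : ∀ k → j ≢ redirect k
  j≢redirect k j≡r with redirect-cases k
  ... | inj₁ (_ , r≡i)   = i≢j (sym (trans j≡r r≡i))
  ... | inj₂ (k≢j , r≡k) = k≢j (sym (trans j≡r r≡k))

  fuse : Fin (suc c) → Fin c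
  fuse k = punchOut (j≢redirect k)

  fuse-injective : ∀ k l → fuse k ≡ fuse l → redirect k ≡ redirect l
  fuse-injective k l = punchOut-injective (j≢redirect k) (j≢redirect l)

  fuse-identifies : fuse i ≡ fuse j
  fuse-identifies with redirect-cases i | redirect-cases j
  ... | inj₁ (i≡j , _)  | _               = ⊥-elim (i≢j i≡j)
  ... | _               | inj₂ (j≢j , _)  = ⊥-elim (j≢j refl)
  ... | inj₂ (_ , ri≡i) | inj₁ (_ , rj≡i) = punchOut-cong j (trans ri≡i (sym rj≡i))

  fuse-surjective : ∀ m → ∃ λ k → fuse k ≡ m
  fuse-surjective m = punchIn j m , trans (punchOut-cong j redirect-fixes) (punchOut-punchIn j)
    where
    redirect-fixes : redirect (punchIn j m) ≡ punchIn j m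
    redirect-fixes with redirect-cases (punchIn j m)
    ... | inj₁ (p≡j , _) = ⊥-elim (punchInᵢ≢i j m p≡j)
    ... | inj₂ (_ , r≡p) = r≡p

module EdgeListComponents {A : Set} {N : ℕ} (index : A ↔ Fin N) where

  Edges : Set
  Edges = List (A × A)

  Edge : Edges → Rel A 0ℓ
  Edge L x y = (x , y) ∈ L

  Conn : Edges → Rel A 0ℓ
  Conn L = EqClosure (Edge L)

  arc : ∀ {L x y} → (x , y) ∈ L → Conn L x y
  arc = EC.return

  private
    isolated : HasComponents (Edge []) N
    isolated = Inverse.to index , (λ i → Inverse.from index i , Inverse.strictlyInverseˡ index i) ,
      λ x y → mk⇔ (λ eq → subst (Conn [] x) (Injection.injective (↔⇒↣ index) eq) ε)
                  (EC.gfold isEquivalence (Inverse.to index) λ ())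

    keep : ∀ {L x y c} → HasComponents (Edge L) c → Conn L x y → HasComponents (Edge ((x , y) ∷ L)) c
    keep {L} {x} {y} H xy = HasComponents-resp H (arc ∘ there) new-arc
      where
      new-arc : Edge ((x , y) ∷ L) ⇒ Conn L
      new-arc (here refl) = xy
      new-arc (there e)   = arc e

    join : ∀ {L x y c} (H : HasComponents (Edge L) (suc c)) → proj₁ H x ≢ proj₁ H y →
           HasComponents (Edge ((x , y) ∷ L)) c
    join {L} {x} {y} (f , f-onto , f-classes) fx≢fy = fuse ∘ f , onto , classes
      where
      open LabelFusion (f x) (f y) fx≢fy
      L⁺ = (x , y) ∷ L
      weaken : Conn L ⇒ Conn L⁺
      weaken = EC.map there
      old : ∀ {a b} → f a ≡ f b → Conn L⁺ a b
      old = weaken ∘ Equivalence.to (f-classes _ _)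
      toward : ∀ a → ∃ λ a′ → Conn L⁺ a a′ × f a′ ≡ redirect (f a)
      toward a with redirect-cases (f a)
      ... | inj₁ (fa≡fy , r≡fx) = x , old fa≡fy ◅◅ EC.symmetric _ (arc (here refl)) , sym r≡fx
      ... | inj₂ (_ , r≡fa)     = a , ε , sym r≡fa
      arc-preserves : Edge L⁺ =[ fuse ∘ f ]⇒ _≡_
      arc-preserves (here refl) = fuse-identifies
      arc-preserves (there e)   = cong fuse (Equivalence.from (f-classes _ _) (arc e))
      connects : ∀ a b → fuse (f a) ≡ fuse (f b) → Conn L⁺ a b
      connects a b eq with toward a | toward b
      ... | a′ , aa′ , fa′ | b′ , bb′ , fb′ =
        aa′ ◅◅ old (trans fa′ (trans (fuse-injective (f a) (f b) eq) (sym fb′))) ◅◅ EC.symmetric _ bb′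
      classes : ∀ a b → (fuse (f a) ≡ fuse (f b)) ⇔ Conn L⁺ a b
      classes a b = mk⇔ (connects a b) (EC.gfold isEquivalence (fuse ∘ f) arc-preserves)
      onto : ∀ m → ∃ λ a → fuse (f a) ≡ m
      onto m with fuse-surjective m
      ... | k , fk≡m with f-onto k
      ... | a , refl = a , fk≡m

    build : ∀ L → Σ ℕ (HasComponents (Edge L))
    build [] = N , isolated
    build ((x , y) ∷ L) with build L
    ... | c , H with proj₁ H x ≟ proj₁ H y
    ... | yes eq = c , keep H (Equivalence.to (proj₂ (proj₂ H) x y) eq)
    build ((x , y) ∷ L) | zero  , (f , _) | no _ = ⊥-elim (¬Fin0 (f x))
    build ((x , y) ∷ L) | suc c , H | no neq = c , join H neq

  components : Edges → ℕ
  components L = proj₁ (build L)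

  components-spec : ∀ L → HasComponents (Edge L) (components L)
  components-spec L = proj₂ (build L)

  Conn? : ∀ L → Decidable (Conn L)
  Conn? L x y with proj₁ (components-spec L) x ≟ proj₁ (components-spec L) y
  ... | yes eq  = yes (Equivalence.to (proj₂ (proj₂ (components-spec L)) x y) eq)
  ... | no  neq = no (neq ∘ Equivalence.from (proj₂ (proj₂ (components-spec L)) x y))

  components-resp : ∀ {L L′} → Edge L ⇒ Conn L′ → Edge L′ ⇒ Conn L → components L ≡ components L′
  components-resp = HasComponents-unique (components-spec _) (components-spec _)

  components-↭ : ∀ {L L′} → L ↭ L′ → components L ≡ components L′
  components-↭ L↭L′ = components-resp (arc ∘ ∈-resp-↭ L↭L′) (arc ∘ ∈-resp-↭ (↭-sym L↭L′))

  components-antitone : ∀ {L L′} → Edge L ⇒ Conn L′ → components L′ ≤ components L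
  components-antitone = HasComponents-≤ (components-spec _) (components-spec _)

  components-∷-connected : ∀ {L x y} → Conn L x y → components ((x , y) ∷ L) ≡ components L
  components-∷-connected {L} xy =
    HasComponents-unique (components-spec _) (keep (components-spec L) xy) arc arc

  components-∷-disconnected : ∀ {L x y} → ¬ Conn L x y → suc (components ((x , y) ∷ L)) ≡ components L
  components-∷-disconnected {L} {x} {y} ¬xy = one-fewer (components-spec L) (components-spec _)
    where
    one-fewer : ∀ {c c′} → HasComponents (Edge L) c → HasComponents (Edge ((x , y) ∷ L)) c′ → suc c′ ≡ c
    one-fewer {zero}  (f , _) _  = ⊥-elim (¬Fin0 (f x))
    one-fewer {suc c} H       H′ =
      cong suc (HasComponents-unique H′ (join H (¬xy ∘ Equivalence.to (proj₂ (proj₂ H) x y))) arc arc)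

  components-≤-suc-∷ : ∀ L q → components L ≤ suc (components (q ∷ L))
  components-≤-suc-∷ L (x , y) with Conn? L x y
  ... | yes xy  = ≤-trans (≤-reflexive (sym (components-∷-connected xy))) (n≤1+n _)
  ... | no  ¬xy = ≤-reflexive (sym (components-∷-disconnected ¬xy))

  components-≤-++ : ∀ P L → components L ≤ components (P ++ L) + length P
  components-≤-++ []      L = ≤-reflexive (sym (+-identityʳ _))
  components-≤-++ (q ∷ P) L = begin
    components L                                ≤⟨ components-≤-++ P L ⟩
    components (P ++ L) + length P              ≤⟨ +-monoˡ-≤ (length P) (components-≤-suc-∷ (P ++ L) q) ⟩
    suc (components (q ∷ P ++ L)) + length P    ≡⟨ sym (+-suc _ (length P)) ⟩
    components (q ∷ P ++ L) + suc (length P)    ∎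
    where open ≤-Reasoning

  components-submodular : ∀ P Q L →
    components (P ++ L) + components (Q ++ L) ≤ components (P ++ Q ++ L) + components L
  components-submodular P []            L = ≤-refl
  components-submodular P ((x , y) ∷ Q) L with Conn? (Q ++ L) x y
  ... | yes xy = begin
    c (P ++ L) + c ((x , y) ∷ Q ++ L)     ≡⟨ cong (c (P ++ L) +_) (components-∷-connected xy) ⟩
    c (P ++ L) + c (Q ++ L)               ≤⟨ components-submodular P Q L ⟩
    c (P ++ Q ++ L) + c L                 ≡⟨ cong (_+ c L) (components-∷-connected (EC.map (∈-++⁺ʳ P) xy)) ⟨
    c ((x , y) ∷ P ++ Q ++ L) + c L       ≡⟨ cong (_+ c L) (components-↭ (shift _ P _)) ⟨
    c (P ++ (x , y) ∷ Q ++ L) + c L       ∎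
    where open ≤-Reasoning; c = components
  ... | no ¬xy = s≤s⁻¹ (begin
    suc (c (P ++ L) + c ((x , y) ∷ Q ++ L)) ≡⟨ +-suc _ _ ⟨
    c (P ++ L) + suc (c ((x , y) ∷ Q ++ L)) ≡⟨ cong (c (P ++ L) +_) (components-∷-disconnected ¬xy) ⟩
    c (P ++ L) + c (Q ++ L)                 ≤⟨ components-submodular P Q L ⟩
    c (P ++ Q ++ L) + c L                   ≤⟨ +-monoˡ-≤ (c L) (components-≤-suc-∷ (P ++ Q ++ L) (x , y)) ⟩
    suc (c ((x , y) ∷ P ++ Q ++ L) + c L)   ≡⟨ cong (λ n → suc n + c L) (components-↭ (shift _ P _)) ⟨
    suc (c (P ++ (x , y) ∷ Q ++ L) + c L)   ∎)
    where open ≤-Reasoning; c = components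

even-or-odd : ∀ k → ∃ λ j → k ≡ j + j ⊎ k ≡ suc (j + j)
even-or-odd zero = zero , inj₁ refl
even-or-odd (suc k) with even-or-odd k
... | j , inj₁ k≡2j = j , inj₂ (cong suc k≡2j)
... | j , inj₂ k≡2j+1 = suc j , inj₁ (cong suc (trans k≡2j+1 (sym (+-suc j j))))

-- A point off the corners has the two distinct neighbours φ₀ p and φ₁ p, a corner only φ₀ p.
-- Alternating φ₀ and φ₁ from a corner therefore traces a path, which must end at a second
-- corner; Inside is the set of points on it.
module CornerPath
  {A : Set} {N : ℕ} (index : A ↣ Fin N)
  (corner : A → Bool) (φ₀ φ₁ : A → A)
  (φ₀-involutive : ∀ p → φ₀ (φ₀ p) ≡ p) (φ₀-fixpoint-free : ∀ p → φ₀ p ≢ p)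
  (φ₁-involutive : ∀ p → φ₁ (φ₁ p) ≡ p) (corner-φ₁ : ∀ p → corner (φ₁ p) ≡ corner p)
  (φ₁-fixpoint-free : ∀ p → corner p ≡ false → φ₁ p ≢ p)
  (start : A) (start-corner : corner start ≡ true)
  where

  private
    true≢false : true ≢ false
    true≢false ()

    φ₀-injective : ∀ {p q} → φ₀ p ≡ φ₀ q → p ≡ q
    φ₀-injective {p} {q} eq = trans (sym (φ₀-involutive p)) (trans (cong φ₀ eq) (φ₀-involutive q))

    φ₁-injective : ∀ {p q} → φ₁ p ≡ φ₁ q → p ≡ q
    φ₁-injective {p} {q} eq = trans (sym (φ₁-involutive p)) (trans (cong φ₁ eq) (φ₁-involutive q))

    walk : ℕ → A
    walk zero    = start
    walk (suc j) = φ₁ (φ₀ (walk j))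

    stops : ℕ → Bool
    stops j = corner (φ₀ (walk j))

    walk-off-corner : ∀ j → stops j ≡ false → corner (walk (suc j)) ≡ false
    walk-off-corner j s = trans (corner-φ₁ (φ₀ (walk j))) s

    FirstStop : ℕ → Set
    FirstStop k = stops k ≡ true × (∀ i → i < k → stops i ≡ false)

    search : ∀ m → ∃ FirstStop ⊎ (∀ i → i < m → stops i ≡ false)
    search zero = inj₂ λ _ ()
    search (suc m) with search m
    ... | inj₁ found = inj₁ found
    ... | inj₂ before with stops m in eq
    ... | true  = inj₁ (m , eq , before)
    ... | false = inj₂ before′
      where
      before′ : ∀ i → i < suc m → stops i ≡ false
      before′ i i≤m with m≤n⇒m<n∨m≡n (s≤s⁻¹ i≤m)
      ... | inj₁ i<m  = before i i<m
      ... | inj₂ refl = eq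

    rewind : ∀ i d → walk i ≡ walk (i + suc d) → walk zero ≡ walk (suc d)
    rewind zero    d eq = eq
    rewind (suc i) d eq = rewind i d (φ₀-injective (φ₁-injective eq))

  -- A walk that never stops would revisit a point, and rewinding brings it back to start.
  private opaque
    must-stop : ∃ FirstStop
    must-stop with search (suc N)
    ... | inj₁ found = found
    ... | inj₂ never with pigeonhole (n<1+n N) (Injection.to index ∘ walk ∘ toℕ)
    ... | i , j , i<j , same with m≤n⇒∃[o]m+o≡n i<j
    ... | d , i+1+d≡j = ⊥-elim (true≢false (trans (sym start-corner)
          (trans (cong corner (rewind (toℕ i) d revisit)) (walk-off-corner d (never d d<1+N)))))
      where
      j≡i+1+d : toℕ i + suc d ≡ toℕ j
      j≡i+1+d = trans (+-suc (toℕ i) d) i+1+d≡j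
      revisit : walk (toℕ i) ≡ walk (toℕ i + suc d)
      revisit = trans (Injection.injective index same) (cong walk (sym j≡i+1+d))
      d<1+N : d < suc N
      d<1+N = <-trans (≤-trans (m≤n+m (suc d) (toℕ i)) (≤-reflexive j≡i+1+d)) (toℕ<n j)

  private
    k : ℕ
    k = proj₁ must-stop

    before-k : ∀ i → i < k → stops i ≡ false
    before-k = proj₂ (proj₂ must-stop)

  end : A
  end = φ₀ (walk k)

  end-corner : corner end ≡ true
  end-corner = proj₁ (proj₂ must-stop)

  Inside : A → Set
  Inside p = ∃ λ j → j ≤ k × (p ≡ walk j ⊎ p ≡ φ₀ (walk j))

  inside-start : Inside start
  inside-start = zero , z≤n , inj₁ refl

  inside-end : Inside end
  inside-end = k , ≤-refl , inj₂ refl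

  private
    inside-φ₀⁺ : ∀ {p} → Inside p → Inside (φ₀ p)
    inside-φ₀⁺ (j , j≤k , inj₁ refl) = j , j≤k , inj₂ refl
    inside-φ₀⁺ (j , j≤k , inj₂ refl) = j , j≤k , inj₁ (φ₀-involutive (walk j))

    inside-φ₁⁺ : ∀ {p} → corner p ≡ false → Inside p → Inside (φ₁ p)
    inside-φ₁⁺ off (zero , _ , inj₁ refl) = ⊥-elim (true≢false (trans (sym start-corner) off))
    inside-φ₁⁺ off (suc j , j<k , inj₁ refl) = j , <⇒≤ j<k , inj₂ (φ₁-involutive (φ₀ (walk j)))
    inside-φ₁⁺ off (j , j≤k , inj₂ refl) with m≤n⇒m<n∨m≡n j≤k
    ... | inj₁ j<k  = suc j , j<k , inj₁ refl
    ... | inj₂ refl = ⊥-elim (true≢false (trans (sym end-corner) off))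

  inside-φ₀ : ∀ p → Inside p ⇔ Inside (φ₀ p)
  inside-φ₀ p = mk⇔ inside-φ₀⁺ (subst Inside (φ₀-involutive p) ∘ inside-φ₀⁺)

  inside-φ₁ : ∀ p → corner p ≡ false → Inside p ⇔ Inside (φ₁ p)
  inside-φ₁ p off = mk⇔ (inside-φ₁⁺ off)
    (subst Inside (φ₁-involutive p) ∘ inside-φ₁⁺ (trans (corner-φ₁ p) off))

  inside-corner : ∀ p → corner p ≡ true → Inside p → p ≡ start ⊎ p ≡ end
  inside-corner p c (zero , _ , inj₁ refl) = inj₁ refl
  inside-corner p c (suc j , j<k , inj₁ refl) =
    ⊥-elim (true≢false (trans (sym c) (walk-off-corner j (before-k j j<k))))
  inside-corner p c (j , j≤k , inj₂ refl) with m≤n⇒m<n∨m≡n j≤k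
  ... | inj₁ j<k  = ⊥-elim (true≢false (trans (sym c) (before-k j j<k)))
  ... | inj₂ refl = inj₂ refl

  private
    -- If the path closed up, it would be a palindrome.
    mirror : end ≡ start → ∀ j i → i + j ≡ k → φ₀ (walk i) ≡ walk j
    mirror closed zero    i i≡k = trans (cong (φ₀ ∘ walk) (trans (sym (+-identityʳ i)) i≡k)) closed
    mirror closed (suc j) i i+1+j≡k =
      trans (sym (φ₁-involutive (φ₀ (walk i))))
            (cong φ₁ (trans (sym (φ₀-involutive (walk (suc i)))) (cong φ₀ inner)))
      where
      inner : φ₀ (walk (suc i)) ≡ walk j
      inner = mirror closed j (suc i) (trans (sym (+-suc i j)) i+1+j≡k)

  end≢start : end ≢ start
  end≢start closed with even-or-odd k
  ... | j , inj₁ k≡2j = φ₀-fixpoint-free (walk j) (mirror closed j j (sym k≡2j))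
  ... | j , inj₂ k≡2j+1 =
    φ₁-fixpoint-free (φ₀ (walk j)) (before-k j j<k)
      (trans (sym (φ₀-involutive (walk (suc j)))) (cong φ₀ (mirror closed j (suc j) (sym k≡2j+1))))
    where
    j<k : j < k
    j<k = ≤-trans (s≤s (m≤m+n j j)) (≤-reflexive (sym k≡2j+1))

  connects : ∀ {R : Rel A 0ℓ} → (∀ p → EqClosure R p (φ₀ p)) →
             (∀ p → corner p ≡ false → EqClosure R p (φ₁ p)) → EqClosure R start end
  connects {R} step₀ step₁ = walk-connects k ≤-refl ◅◅ step₀ (walk k)
    where
    walk-connects : ∀ j → j ≤ k → EqClosure R start (walk j)
    walk-connects zero    _   = ε
    walk-connects (suc j) j<k =
      walk-connects j (<⇒≤ j<k) ◅◅ step₀ (walk j) ◅◅ step₁ (φ₀ (walk j)) (before-k j j<k)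

∈-concat-tabulate⁺ : ∀ {X : Set} {m} (f : Fin m → List X) i {x} → x ∈ f i → x ∈ concat (tabulate f)
∈-concat-tabulate⁺ f i x∈fi = ∈-concat⁺′ x∈fi (∈-tabulate⁺ i)

∈-concat-tabulate⁻ : ∀ {X : Set} {m} (f : Fin m → List X) {x} → x ∈ concat (tabulate f) → ∃ λ i → x ∈ f i
∈-concat-tabulate⁻ f x∈ with ∈-concat⁻′ (tabulate f) x∈
... | xs , x∈xs , xs∈ with ∈-tabulate⁻ xs∈
... | i , refl = i , x∈xs

count : ∀ {m} → (Fin m → Bool) → ℕ
count {zero}  W = 0
count {suc m} W = (if W zero then 1 else 0) + count (W ∘ suc)

length-concat-tabulate-≤ : ∀ {X : Set} {m} (f : Fin m → List X) (W : Fin m → Bool) →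
  (∀ i → length (f i) ≤ (if W i then 1 else 0)) → length (concat (tabulate f)) ≤ count W
length-concat-tabulate-≤ {m = zero}  f W bound = z≤n
length-concat-tabulate-≤ {m = suc m} f W bound =
  ≤-trans (≤-reflexive (length-++ (f zero)))
          (+-mono-≤ (bound zero) (length-concat-tabulate-≤ (f ∘ suc) (W ∘ suc) (bound ∘ suc)))

-- Corner (i , s) of an edge ribbon is side s of its attaching segment at end i.  The boundary of
-- G^{τ(Z)} \ Y joins the four corners of an edge in pairs, by the involution partner K, according
-- to the kind K of the edge there (the constructors del, untw and tw of BArc).  far K is a corner
-- that K does not pair with origin, so a bridge from origin to far K joins the two pairs.
Corner : Set
Corner = Fin 2 × Fin 2

origin : Corner
origin = zero , zero

data Kind : Set where
  deleted untwisted twisted : Kind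

partner : Kind → Corner → Corner
partner deleted   (i , s) = i , flip2 s
partner untwisted (i , s) = flip2 i , flip2 s
partner twisted   (i , s) = flip2 i , s

far : Kind → Corner
far deleted   = suc zero , zero
far untwisted = zero , suc zero
far twisted   = zero , suc zero

partner-involutive : ∀ K c → partner K (partner K c) ≡ c
partner-involutive deleted   (i , zero)     = refl
partner-involutive deleted   (i , suc zero) = refl
partner-involutive untwisted (zero , zero)         = refl
partner-involutive untwisted (zero , suc zero)     = refl
partner-involutive untwisted (suc zero , zero)     = refl
partner-involutive untwisted (suc zero , suc zero) = refl
partner-involutive twisted   (zero , s)     = refl
partner-involutive twisted   (suc zero , s) = refl

partner-fixpoint-free : ∀ K c → partner K c ≢ c
partner-fixpoint-free deleted   (i , zero)     ()
partner-fixpoint-free deleted   (i , suc zero) ()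
partner-fixpoint-free untwisted (zero , s)     ()
partner-fixpoint-free untwisted (suc zero , s) ()
partner-fixpoint-free twisted   (zero , s)     ()
partner-fixpoint-free twisted   (suc zero , s) ()

corner-cases : ∀ K c → c ≡ origin ⊎ c ≡ partner K origin ⊎ c ≡ far K ⊎ c ≡ partner K (far K)
corner-cases deleted   (zero , zero)         = inj₁ refl
corner-cases deleted   (zero , suc zero)     = inj₂ (inj₁ refl)
corner-cases deleted   (suc zero , zero)     = inj₂ (inj₂ (inj₁ refl))
corner-cases deleted   (suc zero , suc zero) = inj₂ (inj₂ (inj₂ refl))
corner-cases untwisted (zero , zero)         = inj₁ refl
corner-cases untwisted (zero , suc zero)     = inj₂ (inj₂ (inj₁ refl))
corner-cases untwisted (suc zero , zero)     = inj₂ (inj₂ (inj₂ refl))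
corner-cases untwisted (suc zero , suc zero) = inj₂ (inj₁ refl)
corner-cases twisted   (zero , zero)         = inj₁ refl
corner-cases twisted   (zero , suc zero)     = inj₂ (inj₂ (inj₁ refl))
corner-cases twisted   (suc zero , zero)     = inj₂ (inj₁ refl)
corner-cases twisted   (suc zero , suc zero) = inj₂ (inj₂ (inj₂ refl))

far-unpaired : ∀ K → far K ≢ origin × far K ≢ partner K origin
far-unpaired deleted   = (λ ()) , (λ ())
far-unpaired untwisted = (λ ()) , (λ ())
far-unpaired twisted   = (λ ()) , (λ ())

pairing : ∀ c → c ≢ origin → ∃ λ K → partner K origin ≡ c
pairing (zero , zero)         c≢o = ⊥-elim (c≢o refl)
pairing (zero , suc zero)     _   = deleted , refl
pairing (suc zero , zero)     _   = twisted , refl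
pairing (suc zero , suc zero) _   = untwisted , refl

partner-origin-injective : ∀ {K K′} → partner K origin ≡ partner K′ origin → K ≡ K′
partner-origin-injective {deleted}   {deleted}   _ = refl
partner-origin-injective {untwisted} {untwisted} _ = refl
partner-origin-injective {twisted}   {twisted}   _ = refl
partner-origin-injective {deleted}   {untwisted} ()
partner-origin-injective {deleted}   {twisted}   ()
partner-origin-injective {untwisted} {deleted}   ()
partner-origin-injective {untwisted} {twisted}   ()
partner-origin-injective {twisted}   {deleted}   ()
partner-origin-injective {twisted}   {untwisted} ()

module Boundary (G : RibbonGraph) where

  Point : Set
  Point = BPoint (ne G)

  pt : Fin (ne G) → Corner → Point
  pt e (i , s) = (e , i) , s

  edgeOf : Point → Fin (ne G)
  edgeOf ((e , _) , _) = e

  opaque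
    point-index : Point ↔ Fin (ne G * 2 * 2)
    point-index = ↔-trans (↔-sym *↔× ×-↔ ↔-refl) (↔-sym *↔×)

  open EdgeListComponents point-index public

  Connects : Edges → Point × Point → Set
  Connects L (u , v) = Conn L u v

  AtEdge : Fin (ne G) → Point × Point → Set
  AtEdge e (u , v) = edgeOf u ≡ e × edgeOf v ≡ e

  Merged : Edges → Fin (ne G) → Set
  Merged L e = ∀ c c′ → Conn L (pt e c) (pt e c′)

  merged-connects : ∀ {L e q} → Merged L e → AtEdge e q → Connects L q
  merged-connects merged (refl , refl) = merged _ _

  kindArcs : Fin (ne G) → Kind → Edges
  kindArcs e K = (pt e origin , pt e (partner K origin)) ∷ (pt e (far K) , pt e (partner K (far K))) ∷ []

  bridge : Fin (ne G) → Kind → Point × Point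
  bridge e K = pt e origin , pt e (far K)

  kindArc-shape : ∀ {e K u v} → (u , v) ∈ kindArcs e K → ∃ λ c → u ≡ pt e c × v ≡ pt e (partner K c)
  kindArc-shape (here refl)         = _ , refl , refl
  kindArc-shape (there (here refl)) = _ , refl , refl

  module _ {L : Edges} {e : Fin (ne G)} {K : Kind} (kind : ∀ {u v} → (u , v) ∈ kindArcs e K → Conn L u v) where

    kindArcs-partner : ∀ c → Conn L (pt e c) (pt e (partner K c))
    kindArcs-partner c with corner-cases K c
    ... | inj₁ refl                 = kind (here refl)
    ... | inj₂ (inj₂ (inj₁ refl))   = kind (there (here refl))
    ... | inj₂ (inj₁ refl)          =
      subst (Conn L (pt e (partner K origin)) ∘ pt e) (sym (partner-involutive K origin))
            (EC.symmetric _ (kind (here refl)))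
    ... | inj₂ (inj₂ (inj₂ refl))   =
      subst (Conn L (pt e (partner K (far K))) ∘ pt e) (sym (partner-involutive K (far K)))
            (EC.symmetric _ (kind (there (here refl))))

    merged-by-bridge : Connects L (bridge e K) → Merged L e
    merged-by-bridge bridged c c′ = EC.symmetric _ (from-origin c) ◅◅ from-origin c′
      where
      from-origin : ∀ c → Conn L (pt e origin) (pt e c)
      from-origin c with corner-cases K c
      ... | inj₁ refl               = ε
      ... | inj₂ (inj₁ refl)        = kind (here refl)
      ... | inj₂ (inj₂ (inj₁ refl)) = bridged
      ... | inj₂ (inj₂ (inj₂ refl)) = bridged ◅◅ kind (there (here refl))

  -- An unassigned edge has its four corners merged, encoded as any matching plus its bridge.
  edgeArcs : Fin (ne G) → Maybe Kind → Edges
  edgeArcs e nothing  = bridge e deleted ∷ kindArcs e deleted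
  edgeArcs e (just K) = kindArcs e K

  edgeArcs-at : ∀ {e X q} → q ∈ edgeArcs e X → AtEdge e q
  edgeArcs-at {X = nothing} (here refl)                 = refl , refl
  edgeArcs-at {X = nothing} (there (here refl))         = refl , refl
  edgeArcs-at {X = nothing} (there (there (here refl))) = refl , refl
  edgeArcs-at {X = just K}  (here refl)                 = refl , refl
  edgeArcs-at {X = just K}  (there (here refl))         = refl , refl

  vertexArc : Dart (ne G) → Point × Point
  vertexArc d = (d , suc zero) , (σ G d , zero)

  vertexArcsAt : Fin (ne G) → Edges
  vertexArcsAt e = tabulate λ i → vertexArc (e , i)

  vertexArcs : Edges
  vertexArcs = concat (tabulate vertexArcsAt)

  State : Set
  State = Fin (ne G) → Maybe Kind

  arcs : State → Edges
  arcs st = vertexArcs ++ concat (tabulate λ e → edgeArcs e (st e))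

  arcs-cong : ∀ {st st′} → (∀ e → st e ≡ st′ e) → arcs st ≡ arcs st′
  arcs-cong st≗st′ = cong (vertexArcs ++_) (cong concat (tabulate-cong (λ e → cong (edgeArcs e) (st≗st′ e))))

  vertexArc∈arcs : ∀ st d → vertexArc d ∈ arcs st
  vertexArc∈arcs st (e , i) =
    ∈-++⁺ˡ (∈-concat-tabulate⁺ vertexArcsAt e (∈-tabulate⁺ {f = λ i → vertexArc (e , i)} i))

  edgeArc∈arcs : ∀ st e {q} → q ∈ edgeArcs e (st e) → q ∈ arcs st
  edgeArc∈arcs st e q∈ = ∈-++⁺ʳ vertexArcs (∈-concat-tabulate⁺ (λ e → edgeArcs e (st e)) e q∈)

  kindArc∈arcs : ∀ st {e K q} → st e ≡ just K → q ∈ kindArcs e K → q ∈ arcs st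
  kindArc∈arcs st {e} st-e q∈ = edgeArc∈arcs st e (subst (λ X → _ ∈ edgeArcs e X) (sym st-e) q∈)

  arcs-cases : ∀ st {q} → q ∈ arcs st → (∃ λ d → q ≡ vertexArc d) ⊎ (∃ λ e → q ∈ edgeArcs e (st e))
  arcs-cases st q∈ with ∈-++⁻ vertexArcs q∈
  ... | inj₂ q∈edge = inj₂ (∈-concat-tabulate⁻ _ q∈edge)
  ... | inj₁ q∈vertex with ∈-concat-tabulate⁻ vertexArcsAt q∈vertex
  ... | e , q∈e with ∈-tabulate⁻ {f = λ i → vertexArc (e , i)} q∈e
  ... | i , q≡ = inj₁ ((e , i) , q≡)

  arcs-merged : ∀ st e → st e ≡ nothing → Merged (arcs st) e
  arcs-merged st e st-e =
    merged-by-bridge {K = deleted} (arc ∘ edgeArc∈arcs st e ∘ inside ∘ there)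
                                   (arc (edgeArc∈arcs st e (inside (here refl))))
    where
    inside : ∀ {q} → q ∈ edgeArcs e nothing → q ∈ edgeArcs e (st e)
    inside = subst (λ X → _ ∈ edgeArcs e X) (sym st-e)

  _⊑_ : State → State → Set
  st ⊑ st′ = ∀ e → st e ≡ nothing ⊎ st e ≡ st′ e

  arcs-⊑ : ∀ {st st′} → st ⊑ st′ → Edge (arcs st′) ⇒ Conn (arcs st)
  arcs-⊑ {st} {st′} st⊑st′ q∈ with arcs-cases st′ q∈
  ... | inj₁ (d , refl) = arc (vertexArc∈arcs st d)
  ... | inj₂ (e , q∈e) with st⊑st′ e
  ... | inj₁ st-e = merged-connects (arcs-merged st e st-e) (edgeArcs-at q∈e)
  ... | inj₂ st-e = arc (edgeArc∈arcs st e (subst (λ X → _ ∈ edgeArcs e X) (sym st-e) q∈e))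

  _⟨_≔_⟩ : State → Fin (ne G) → Kind → State
  (st ⟨ e ≔ K ⟩) e′ = if does (e′ ≟ e) then just K else st e′

  ≔-here : ∀ st e K → (st ⟨ e ≔ K ⟩) e ≡ just K
  ≔-here st e K rewrite dec-true (e ≟ e) refl = refl

  unassign : (Fin (ne G) → Bool) → State → State
  unassign W st e = if W e then nothing else st e

  BridgeList : (Fin (ne G) → Bool) → State → Edges → Set
  BridgeList W st P = (∀ {q} → q ∈ P → ∃ λ e → W e ≡ true × AtEdge e q) ×
                      (∀ e {K} → W e ≡ true → st e ≡ just K → bridge e K ∈ P)

  bridging : ∀ {W st P} → BridgeList W st P → components (P ++ arcs st) ≡ components (arcs (unassign W st))
  bridging {W} {st} {P} (local , complete) = components-resp forward backward
    where
    unassign-⊑ : unassign W st ⊑ st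
    unassign-⊑ e with W e
    ... | true  = inj₁ refl
    ... | false = inj₂ refl

    unassigned : ∀ e → W e ≡ true → unassign W st e ≡ nothing
    unassigned e We rewrite We = refl

    forward : Edge (P ++ arcs st) ⇒ Conn (arcs (unassign W st))
    forward q∈ with ∈-++⁻ P q∈
    ... | inj₂ q∈arcs = arcs-⊑ unassign-⊑ q∈arcs
    ... | inj₁ q∈P with local q∈P
    ... | e , We , at = merged-connects (arcs-merged _ e (unassigned e We)) at

    lift : Conn (arcs st) ⇒ Conn (P ++ arcs st)
    lift = EC.map (∈-++⁺ʳ P)

    merged : ∀ e → W e ≡ true → Merged (P ++ arcs st) e
    merged e We with st e in st-e
    ... | nothing = λ c c′ → lift (arcs-merged st e st-e c c′)
    ... | just K  = merged-by-bridge {K = K} (lift ∘ arc ∘ kindArc∈arcs st st-e)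
                                             (arc (∈-++⁺ˡ (complete e We st-e)))

    backward : Edge (arcs (unassign W st)) ⇒ Conn (P ++ arcs st)
    backward q∈ with arcs-cases (unassign W st) q∈
    ... | inj₁ (d , refl) = arc (∈-++⁺ʳ P (vertexArc∈arcs st d))
    ... | inj₂ (e , q∈e) with W e in We
    ... | true  = merged-connects (merged e We) (edgeArcs-at {X = nothing} q∈e)
    ... | false = arc (∈-++⁺ʳ P (edgeArc∈arcs st e q∈e))

  BridgeList-++ : ∀ {W W′ st P Q} → BridgeList W st P → BridgeList W′ st Q →
                  BridgeList (λ e → W e ∨ W′ e) st (P ++ Q)
  BridgeList-++ {W} {W′} {st} {P} {Q} (localP , completeP) (localQ , completeQ) = local , complete
    where
    local : ∀ {q} → q ∈ P ++ Q → ∃ λ e → W e ∨ W′ e ≡ true × AtEdge e q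
    local q∈ with ∈-++⁻ P q∈
    ... | inj₁ q∈P with localP q∈P
    ... | e , We , at = e , cong (_∨ W′ e) We , at
    local q∈ | inj₂ q∈Q with localQ q∈Q
    ... | e , W′e , at = e , trans (cong (W e ∨_) W′e) (∨-zeroʳ (W e)) , at
    complete : ∀ e {K} → W e ∨ W′ e ≡ true → st e ≡ just K → bridge e K ∈ P ++ Q
    complete e W∨W′ st-e with W e in We
    ... | true  = ∈-++⁺ˡ (completeP e We st-e)
    ... | false = ∈-++⁺ʳ P (completeQ e W∨W′ st-e)

  bridgeOf : Fin (ne G) → Maybe Kind → Edges
  bridgeOf e nothing  = []
  bridgeOf e (just K) = [ bridge e K ]

  bridges : (Fin (ne G) → Bool) → State → Edges
  bridges W st = concat (tabulate λ e → if W e then bridgeOf e (st e) else [])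

  bridges-BridgeList : ∀ W st → BridgeList W st (bridges W st)
  bridges-BridgeList W st = local , complete
    where
    local : ∀ {q} → q ∈ bridges W st → ∃ λ e → W e ≡ true × AtEdge e q
    local q∈ with ∈-concat-tabulate⁻ (λ e → if W e then bridgeOf e (st e) else []) q∈
    ... | e , q∈e with W e in We | st e
    ... | true  | just K with q∈e
    ... | here refl = e , We , refl , refl
    local q∈ | e , () | true  | nothing
    local q∈ | e , () | false | _
    complete : ∀ e {K} → W e ≡ true → st e ≡ just K → bridge e K ∈ bridges W st
    complete e {K} We st-e = ∈-concat-tabulate⁺ (λ e → if W e then bridgeOf e (st e) else []) e bridge∈
      where
      bridge∈ : bridge e K ∈ (if W e then bridgeOf e (st e) else [])
      bridge∈ rewrite We | st-e = here refl

  length-bridges : ∀ W st (V : Fin (ne G) → Bool) → (∀ e → W e ≡ true → is-just (st e) ≡ true → V e ≡ true) →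
                   length (bridges W st) ≤ count V
  length-bridges W st V covered = length-concat-tabulate-≤ _ V bound
    where
    bound : ∀ e → length (if W e then bridgeOf e (st e) else []) ≤ (if V e then 1 else 0)
    bound e with W e in We | st e in st-e
    ... | false | _       = z≤n
    ... | true  | nothing = z≤n
    ... | true  | just K rewrite covered e We (cong is-just st-e) = ≤-refl

  bridging-one : ∀ st e K → st e ≡ nothing →
                 components (bridge e K ∷ arcs (st ⟨ e ≔ K ⟩)) ≡ components (arcs st)
  bridging-one st e K st-e = trans (bridging (local , complete)) (cong components (arcs-cong restored))
    where
    at-e : Fin (ne G) → Bool
    at-e e′ = does (e′ ≟ e)
    local : ∀ {q} → q ∈ [ bridge e K ] → ∃ λ e′ → at-e e′ ≡ true × AtEdge e′ q
    local (here refl) = e , dec-true (e ≟ e) refl , refl , refl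
    complete : ∀ e′ {K′} → at-e e′ ≡ true → (st ⟨ e ≔ K ⟩) e′ ≡ just K′ → bridge e′ K′ ∈ [ bridge e K ]
    complete e′ at with e′ ≟ e
    complete e′ () | no _
    ... | yes refl = λ { refl → here refl }
    restored : ∀ e′ → unassign at-e (st ⟨ e ≔ K ⟩) e′ ≡ st e′
    restored e′ with e′ ≟ e
    ... | yes refl = sym st-e
    ... | no _     = refl

  pt-injective : ∀ {e e′ c c′} → pt e c ≡ pt e′ c′ → c ≡ c′
  pt-injective {c = _ , _} {c′ = _ , _} refl = refl

  pt-edgeOf : ∀ {e} p → edgeOf p ≡ e → p ≡ pt e (proj₂ (proj₁ p) , proj₂ p)
  pt-edgeOf _ refl = refl

across : Maybe Kind → Corner → Corner
across nothing  c = c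
across (just K) c = partner K c

across-involutive : ∀ X c → across X (across X c) ≡ c
across-involutive nothing  c = refl
across-involutive (just K) c = partner-involutive K c

module UnbridgedKind (G : RibbonGraph) where

  open Boundary G

  Bridged : State → Fin (ne G) → Kind → Set
  Bridged st e K = Connects (arcs (st ⟨ e ≔ K ⟩)) (bridge e K)

  -- With every edge but e assigned, φ₀ follows vertex arcs and φ₁ the matchings at the other
  -- edges; the corners of the path are origin and endCorner of e.  The kind `paired` matching
  -- these two has its bridge leave the path, every other kind has endCorner in its far pair.
  module _ (st : State) (e : Fin (ne G)) (st-e : st e ≡ nothing)
           (assigned : ∀ e′ → e′ ≢ e → ∃ λ K → st e′ ≡ just K) where

    private
      σ⁻¹ : Dart (ne G) → Dart (ne G)
      σ⁻¹ = Inverse.from (rot G)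

      φ₀ : Point → Point
      φ₀ (d , zero)     = σ⁻¹ d , suc zero
      φ₀ (d , suc zero) = σ G d , zero

      φ₁ : Point → Point
      φ₁ ((e′ , i) , s) = pt e′ (across (st e′) (i , s))

      corner : Point → Bool
      corner p = is-nothing (st (edgeOf p))

      φ₀-involutive : ∀ p → φ₀ (φ₀ p) ≡ p
      φ₀-involutive (d , zero)     = cong (_, zero) (Inverse.strictlyInverseˡ (rot G) d)
      φ₀-involutive (d , suc zero) = cong (_, suc zero) (Inverse.strictlyInverseʳ (rot G) d)

      φ₀-fixpoint-free : ∀ p → φ₀ p ≢ p
      φ₀-fixpoint-free (d , zero)     ()
      φ₀-fixpoint-free (d , suc zero) ()

      φ₁-involutive : ∀ p → φ₁ (φ₁ p) ≡ p
      φ₁-involutive ((e′ , i) , s) = cong (pt e′) (across-involutive (st e′) (i , s))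

      φ₁-fixpoint-free : ∀ p → corner p ≡ false → φ₁ p ≢ p
      φ₁-fixpoint-free ((e′ , i) , s) off with st e′
      ... | just K = partner-fixpoint-free K (i , s) ∘ pt-injective

      start : Point
      start = pt e origin

      start-corner : corner start ≡ true
      start-corner rewrite st-e = refl

    open CornerPath (↔⇒↣ point-index) corner φ₀ φ₁ φ₀-involutive φ₀-fixpoint-free
                    φ₁-involutive (λ _ → refl) φ₁-fixpoint-free start start-corner

    private
      at-e : ∀ p → corner p ≡ true → edgeOf p ≡ e
      at-e p c with edgeOf p ≟ e
      ... | yes at = at
      ... | no away with assigned (edgeOf p) away
      ... | K , st-p rewrite st-p with c
      ... | ()

      endCorner : Corner
      endCorner = proj₂ (proj₁ end) , proj₂ end

      end≡ : end ≡ pt e endCorner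
      end≡ = pt-edgeOf end (at-e end end-corner)

      endCorner≢origin : endCorner ≢ origin
      endCorner≢origin eq = end≢start (trans end≡ (cong (pt e) eq))

    paired : Kind
    paired = proj₁ (pairing endCorner endCorner≢origin)

    private
      paired-origin : partner paired origin ≡ endCorner
      paired-origin = proj₂ (pairing endCorner endCorner≢origin)

      kindArcs-here : ∀ K → ∀ {u v} → (u , v) ∈ kindArcs e K → Conn (arcs (st ⟨ e ≔ K ⟩)) u v
      kindArcs-here K = arc ∘ kindArc∈arcs (st ⟨ e ≔ K ⟩) (≔-here st e K)

      elsewhere : ∀ {e′ K′} K → st e′ ≡ just K′ → (st ⟨ e ≔ K ⟩) e′ ≡ just K′
      elsewhere {e′} K st-e′ with e′ ≟ e
      ... | yes refl = contradiction (trans (sym st-e′) st-e) λ ()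
      ... | no _     = st-e′

      walk-connects : ∀ K → Conn (arcs (st ⟨ e ≔ K ⟩)) start (pt e endCorner)
      walk-connects K = subst (Conn _ start) end≡ (connects step₀ step₁)
        where
        L = arcs (st ⟨ e ≔ K ⟩)
        step₀ : ∀ p → Conn L p (φ₀ p)
        step₀ (d , suc zero) = arc (vertexArc∈arcs _ d)
        step₀ (d , zero)     = subst (λ d′ → Conn L (d′ , zero) (σ⁻¹ d , suc zero))
          (Inverse.strictlyInverseˡ (rot G) d) (EC.symmetric _ (arc (vertexArc∈arcs _ (σ⁻¹ d))))
        step₁ : ∀ p → corner p ≡ false → Conn L p (φ₁ p)
        step₁ ((e′ , i) , s) off with st e′ in st-e′
        ... | just K′ = kindArcs-partner {K = K′} (arc ∘ kindArc∈arcs _ (elsewhere K st-e′)) (i , s)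

    bridged-unless-paired : ∀ K → K ≢ paired → Bridged st e K
    bridged-unless-paired K K≢paired with corner-cases K endCorner
    ... | inj₁ at-origin = ⊥-elim (endCorner≢origin at-origin)
    ... | inj₂ (inj₁ at-partner) =
      ⊥-elim (K≢paired (partner-origin-injective (trans (sym at-partner) (sym paired-origin))))
    ... | inj₂ (inj₂ (inj₁ at-far)) = subst (Conn L start ∘ pt e) at-far (walk-connects K)
      where L = arcs (st ⟨ e ≔ K ⟩)
    ... | inj₂ (inj₂ (inj₂ at-partner-far)) =
      subst (Conn L start ∘ pt e) at-partner-far (walk-connects K) ◅◅
      subst (Conn L (pt e (partner K (far K))) ∘ pt e) (partner-involutive K (far K))
            (kindArcs-partner {K = K} (kindArcs-here K) (partner K (far K)))
      where L = arcs (st ⟨ e ≔ K ⟩)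

    private
      -- The only corners inside the path are the two corners joined by the matching of `paired`.
      pair-closed⁺ : ∀ c → Inside (pt e c) → Inside (pt e (partner paired c))
      pair-closed⁺ c inside with inside-corner (pt e c) start-corner inside
      ... | inj₁ c-start = subst Inside (trans end≡ (cong (pt e) (sym to-end))) inside-end
        where
        to-end : partner paired c ≡ endCorner
        to-end = trans (cong (partner paired) (pt-injective c-start)) paired-origin
      ... | inj₂ c-end = subst Inside (cong (pt e) (sym to-start)) inside-start
        where
        to-start : partner paired c ≡ origin
        to-start = trans (cong (partner paired) (trans (pt-injective (trans c-end end≡)) (sym paired-origin)))
                         (partner-involutive paired origin)

      pair-closed : ∀ c → Inside (pt e c) ⇔ Inside (pt e (partner paired c))
      pair-closed c = mk⇔ (pair-closed⁺ c)
        (subst (Inside ∘ pt e) (partner-involutive paired c) ∘ pair-closed⁺ (partner paired c))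

      inside-arc : Edge (arcs (st ⟨ e ≔ paired ⟩)) =[ Inside ]⇒ _⇔_
      inside-arc {u} {v} q∈ with arcs-cases _ q∈
      ... | inj₁ (d , refl) = inside-φ₀ (d , suc zero)
      ... | inj₂ (e′ , q∈e′) with e′ ≟ e
      ... | yes refl with kindArc-shape {K = paired} q∈e′
      ... | c , refl , refl = pair-closed c
      inside-arc {u} {v} q∈ | inj₂ (e′ , q∈e′) | no e′≢e with assigned e′ e′≢e
      ... | K′ , st-e′ with kindArc-shape {K = K′} (subst (λ X → (u , v) ∈ edgeArcs e′ X) st-e′ q∈e′)
      ... | (i , s) , refl , refl =
        subst (λ p → Inside (pt e′ (i , s)) ⇔ Inside p) φ₁≡ (inside-φ₁ (pt e′ (i , s)) off)
        where
        φ₁≡ : φ₁ (pt e′ (i , s)) ≡ pt e′ (partner K′ (i , s))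
        φ₁≡ rewrite st-e′ = refl
        off : corner (pt e′ (i , s)) ≡ false
        off rewrite st-e′ = refl

    paired-unbridged : ¬ Bridged st e paired
    paired-unbridged bridged with inside-corner (pt e (far paired)) start-corner inside-far
      where
      inside-far : Inside (pt e (far paired))
      inside-far = Equivalence.to (EC.gfold ⇔-isEquivalence Inside inside-arc bridged) inside-start
    ... | inj₁ far-start = proj₁ (far-unpaired paired) (pt-injective far-start)
    ... | inj₂ far-end   = proj₂ (far-unpaired paired) (trans (pt-injective (trans far-end end≡)) (sym paired-origin))

-- The choices ė, ē, ê at an edge with twist t, as a kind of the edge in G^{τ(Z)} \ Y.
kindOf : Fin 3 → Bool → Kind
kindOf zero             t = if t then twisted else untwisted
kindOf (suc zero)       t = deleted
kindOf (suc (suc zero)) t = if t then untwisted else twisted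

choiceOf : Kind → Bool → Fin 3
choiceOf deleted   t = suc zero
choiceOf untwisted t = if t then suc (suc zero) else zero
choiceOf twisted   t = if t then zero else suc (suc zero)

kindOf-choiceOf : ∀ K t → kindOf (choiceOf K t) t ≡ K
kindOf-choiceOf deleted   t     = refl
kindOf-choiceOf untwisted true  = refl
kindOf-choiceOf untwisted false = refl
kindOf-choiceOf twisted   true  = refl
kindOf-choiceOf twisted   false = refl

choiceOf-kindOf : ∀ x t → choiceOf (kindOf x t) t ≡ x
choiceOf-kindOf zero             true  = refl
choiceOf-kindOf zero             false = refl
choiceOf-kindOf (suc zero)       t     = refl
choiceOf-kindOf (suc (suc zero)) true  = refl
choiceOf-kindOf (suc (suc zero)) false = refl

size-count : ∀ {n k} (S : SubTr n k) → size S ≡ count (is-just ∘ S)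
size-count {zero}  S = refl
size-count {suc n} S = cong ((if is-just (S zero) then 1 else 0) +_) (size-count (S ∘ suc))

size-restrict : ∀ {n k} (t : Fin n → Fin k) (A : Subset n) → size (restrict t A) ≡ ∣ A ∣
size-restrict t []          = refl
size-restrict t (true ∷ A)  = cong suc (size-restrict (t ∘ suc) A)
size-restrict t (false ∷ A) = size-restrict (t ∘ suc) A

size-update : ∀ {n k} (S : SubTr n k) e x → S e ≡ nothing → size (S [ e ↦ x ]) ≡ suc (size S)
size-update {suc n} S zero    x S-e rewrite S-e = refl
size-update {suc n} S (suc e) x S-e =
  trans (cong ((if is-just (S zero) then 1 else 0) +_) (size-update (S ∘ suc) e x S-e)) (+-suc _ _)

∣∪∣+∣∩∣ : ∀ {n} (A B : Subset n) → ∣ A ∪ B ∣ + ∣ A ∩ B ∣ ≡ ∣ A ∣ + ∣ B ∣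
∣∪∣+∣∩∣ []          []          = refl
∣∪∣+∣∩∣ (true ∷ A)  (true ∷ B)  = cong suc (trans (+-suc _ _) (trans (cong suc (∣∪∣+∣∩∣ A B)) (sym (+-suc _ _))))
∣∪∣+∣∩∣ (true ∷ A)  (false ∷ B) = cong suc (∣∪∣+∣∩∣ A B)
∣∪∣+∣∩∣ (false ∷ A) (true ∷ B)  = trans (cong suc (∣∪∣+∣∩∣ A B)) (sym (+-suc _ _))
∣∪∣+∣∩∣ (false ∷ A) (false ∷ B) = ∣∪∣+∣∩∣ A B

∣∣+count-difference : ∀ {n} (A B : Subset n) → A ⊆ B → ∣ A ∣ + count (λ e → lookup B e ∧ not (lookup A e)) ≡ ∣ B ∣
∣∣+count-difference []          []          A⊆B = refl
∣∣+count-difference (true ∷ A)  (true ∷ B)  A⊆B = cong suc (∣∣+count-difference A B (drop-∷-⊆ A⊆B))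
∣∣+count-difference (true ∷ A)  (false ∷ B) A⊆B with A⊆B Vec.here
... | ()
∣∣+count-difference (false ∷ A) (true ∷ B)  A⊆B =
  trans (+-suc _ _) (cong suc (∣∣+count-difference A B (drop-∷-⊆ A⊆B)))
∣∣+count-difference (false ∷ A) (false ∷ B) A⊆B = ∣∣+count-difference A B (drop-∷-⊆ A⊆B)

double+1 : ∀ r → 2 * r + 1 ≡ suc r + r
double+1 r rewrite +-identityʳ r = +-comm (r + r) 1

module Rank (G : RibbonGraph) where

  open Boundary G
  open UnbridgedKind G

  state : SubTr (ne G) 3 → State
  state S e = Maybe.map (λ x → kindOf x (twist G e)) (S e)

  unassigned : State
  unassigned _ = nothing

  k₀ : ℕ
  k₀ = components (arcs unassigned)

  comps : SubTr (ne G) 3 → ℕ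
  comps S = components (arcs (state S))

  -- The subtraction never truncates, by rank+comps below.
  rank : SubTr (ne G) 3 → ℕ
  rank S = size S + k₀ ∸ comps S

  k₀≤comps : ∀ S → k₀ ≤ comps S
  k₀≤comps S = components-antitone (arcs-⊑ {unassigned} {state S} λ _ → inj₁ refl)

  comps≤size+k₀ : ∀ S → comps S ≤ size S + k₀
  comps≤size+k₀ S = begin
    comps S                          ≤⟨ components-≤-++ P (arcs (state S)) ⟩
    components (P ++ arcs (state S)) + length P ≡⟨ cong (_+ length P) (bridging (bridges-BridgeList _ _)) ⟩
    k₀ + length P                    ≤⟨ +-monoʳ-≤ k₀ (length-bridges _ _ (is-just ∘ S) assigned) ⟩
    k₀ + count (is-just ∘ S)         ≡⟨ cong (k₀ +_) (sym (size-count S)) ⟩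
    k₀ + size S                      ≡⟨ +-comm k₀ (size S) ⟩
    size S + k₀                      ∎
    where
    open ≤-Reasoning
    P = bridges (λ _ → true) (state S)
    assigned : ∀ e → true ≡ true → is-just (state S e) ≡ true → is-just (S e) ≡ true
    assigned e _ with S e
    ... | just _ = λ _ → refl

  rank+comps : ∀ S → rank S + comps S ≡ size S + k₀
  rank+comps S = m∸n+n≡m (comps≤size+k₀ S)

  rank≤size : ∀ S → rank S ≤ size S
  rank≤size S = ≤-trans (∸-monoʳ-≤ (size S + k₀) (k₀≤comps S)) (≤-reflexive (m+n∸n≡m (size S) k₀))

  state-restrict-unassign : ∀ t (A B : Subset (ne G)) W → (∀ e → lookup A e ≡ lookup B e ∧ not (W e)) →
                            ∀ e → unassign W (state (restrict t B)) e ≡ state (restrict t A) e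
  state-restrict-unassign t A B W A≗B∖W e rewrite A≗B∖W e with lookup B e | W e
  ... | true  | true  = refl
  ... | true  | false = refl
  ... | false | true  = refl
  ... | false | false = refl

  comps-restrict-bridging : ∀ t (A B : Subset (ne G)) {W P} → BridgeList W (state (restrict t B)) P →
    (∀ e → lookup A e ≡ lookup B e ∧ not (W e)) →
    components (P ++ arcs (state (restrict t B))) ≡ comps (restrict t A)
  comps-restrict-bridging t A B {W} bridgeList A≗B∖W =
    trans (bridging bridgeList) (cong components (arcs-cong (state-restrict-unassign t A B W A≗B∖W)))

  comps-restrict-antitone : ∀ t (A B : Subset (ne G)) → A ⊆ B →
    comps (restrict t B) ≤ comps (restrict t A) + count (λ e → lookup B e ∧ not (lookup A e))
  comps-restrict-antitone t A B A⊆B = begin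
    comps (restrict t B)                    ≤⟨ components-≤-++ P _ ⟩
    components (P ++ arcs (state (restrict t B))) + length P
      ≡⟨ cong (_+ length P) (comps-restrict-bridging t A B (bridges-BridgeList D _) A≗B∖D) ⟩
    comps (restrict t A) + length P         ≤⟨ +-monoʳ-≤ _ (length-bridges D _ D λ _ De _ → De) ⟩
    comps (restrict t A) + count D          ∎
    where
    open ≤-Reasoning
    D : Fin (ne G) → Bool
    D e = lookup B e ∧ not (lookup A e)
    P = bridges D (state (restrict t B))
    A≗B∖D : ∀ e → lookup A e ≡ lookup B e ∧ not (D e)
    A≗B∖D e with lookup A e in Ae | lookup B e in Be
    ... | true  | true  = refl
    ... | true  | false = trans (sym ([]=⇒lookup (A⊆B (lookup⇒[]= e A Ae)))) Be
    ... | false | true  = refl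
    ... | false | false = refl

  comps-restrict-submodular : ∀ t (A B : Subset (ne G)) →
    comps (restrict t A) + comps (restrict t B) ≤ comps (restrict t (A ∩ B)) + comps (restrict t (A ∪ B))
  comps-restrict-submodular t A B =
    subst₂ _≤_ (cong₂ _+_ (at A notA P-bridges A-part) (at B notB Q-bridges B-part))
               (cong₂ _+_ (trans (cong components (sym (++-assoc P Q L)))
                                 (at (A ∩ B) (λ e → notA e ∨ notB e) (BridgeList-++ P-bridges Q-bridges) A∩B-part))
                          refl)
               (components-submodular P Q L)
    where
    notA notB : Fin (ne G) → Bool
    notA e = not (lookup A e)
    notB e = not (lookup B e)
    st = state (restrict t (A ∪ B))
    L = arcs st
    P = bridges notA st
    Q = bridges notB st
    P-bridges = bridges-BridgeList notA st
    Q-bridges = bridges-BridgeList notB st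
    at : ∀ C W {R} → BridgeList W st R → (∀ e → lookup C e ≡ lookup (A ∪ B) e ∧ not (W e)) →
         components (R ++ L) ≡ comps (restrict t C)
    at C W bridgeList = comps-restrict-bridging t C (A ∪ B) bridgeList
    A-part : ∀ e → lookup A e ≡ lookup (A ∪ B) e ∧ not (notA e)
    A-part e rewrite lookup-zipWith _∨_ e A B with lookup A e | lookup B e
    ... | true  | _     = refl
    ... | false | true  = refl
    ... | false | false = refl
    B-part : ∀ e → lookup B e ≡ lookup (A ∪ B) e ∧ not (notB e)
    B-part e rewrite lookup-zipWith _∨_ e A B with lookup A e | lookup B e
    ... | true  | true  = refl
    ... | true  | false = refl
    ... | false | true  = refl
    ... | false | false = refl
    A∩B-part : ∀ e → lookup (A ∩ B) e ≡ lookup (A ∪ B) e ∧ not (notA e ∨ notB e)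
    A∩B-part e rewrite lookup-zipWith _∨_ e A B | lookup-zipWith _∧_ e A B with lookup A e | lookup B e
    ... | true  | true  = refl
    ... | true  | false = refl
    ... | false | true  = refl
    ... | false | false = refl

  rank-restrict-isMatroidRank : ∀ t → IsMatroidRank (λ A → rank (restrict t A))
  rank-restrict-isMatroidRank t = record { bounded = bounded ; monotone = monotone ; submodular = submodular }
    where
    open ≤-Reasoning
    ρ c : Subset (ne G) → ℕ
    ρ A = rank (restrict t A)
    c A = comps (restrict t A)

    ρ+c : ∀ A → ρ A + c A ≡ ∣ A ∣ + k₀
    ρ+c A = trans (rank+comps (restrict t A)) (cong (_+ k₀) (size-restrict t A))

    bounded : ∀ A → ρ A ≤ ∣ A ∣
    bounded A = ≤-trans (rank≤size _) (≤-reflexive (size-restrict t A))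

    monotone : ∀ A B → A ⊆ B → ρ A ≤ ρ B
    monotone A B A⊆B = +-cancelʳ-≤ (c B) (ρ A) (ρ B) (begin
      ρ A + c B        ≤⟨ +-monoʳ-≤ (ρ A) (comps-restrict-antitone t A B A⊆B) ⟩
      ρ A + (c A + d)  ≡⟨ sym (+-assoc (ρ A) (c A) d) ⟩
      ρ A + c A + d    ≡⟨ cong (_+ d) (ρ+c A) ⟩
      ∣ A ∣ + k₀ + d   ≡⟨ xy∙z≈xz∙y (∣ A ∣) k₀ d ⟩
      ∣ A ∣ + d + k₀   ≡⟨ cong (_+ k₀) (∣∣+count-difference A B A⊆B) ⟩
      ∣ B ∣ + k₀       ≡⟨ sym (ρ+c B) ⟩
      ρ B + c B        ∎)
      where d = count (λ e → lookup B e ∧ not (lookup A e))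

    submodular : ∀ A B → ρ (A ∪ B) + ρ (A ∩ B) ≤ ρ A + ρ B
    submodular A B = +-cancelʳ-≤ (c (A ∪ B) + c (A ∩ B)) (ρ (A ∪ B) + ρ (A ∩ B)) (ρ A + ρ B) (begin
      (ρ (A ∪ B) + ρ (A ∩ B)) + (c (A ∪ B) + c (A ∩ B)) ≡⟨ interchange (ρ (A ∪ B)) _ _ _ ⟩
      (ρ (A ∪ B) + c (A ∪ B)) + (ρ (A ∩ B) + c (A ∩ B)) ≡⟨ cong₂ _+_ (ρ+c (A ∪ B)) (ρ+c (A ∩ B)) ⟩
      (∣ A ∪ B ∣ + k₀) + (∣ A ∩ B ∣ + k₀)               ≡⟨ interchange (∣ A ∪ B ∣) k₀ (∣ A ∩ B ∣) k₀ ⟩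
      (∣ A ∪ B ∣ + ∣ A ∩ B ∣) + (k₀ + k₀)               ≡⟨ cong (_+ (k₀ + k₀)) (∣∪∣+∣∩∣ A B) ⟩
      (∣ A ∣ + ∣ B ∣) + (k₀ + k₀)                       ≡⟨ interchange (∣ A ∣) (∣ B ∣) k₀ k₀ ⟩
      (∣ A ∣ + k₀) + (∣ B ∣ + k₀)                       ≡⟨ cong₂ _+_ (sym (ρ+c A)) (sym (ρ+c B)) ⟩
      (ρ A + c A) + (ρ B + c B)                         ≡⟨ interchange (ρ A) (c A) (ρ B) (c B) ⟩
      (ρ A + ρ B) + (c A + c B)                         ≤⟨ +-monoʳ-≤ (ρ A + ρ B) (comps-restrict-submodular t A B) ⟩
      (ρ A + ρ B) + (c (A ∩ B) + c (A ∪ B))             ≡⟨ cong ((ρ A + ρ B) +_) (+-comm (c (A ∩ B)) (c (A ∪ B))) ⟩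
      (ρ A + ρ B) + (c (A ∪ B) + c (A ∩ B))             ∎)

  state-update : ∀ S e x e′ → state (S [ e ↦ x ]) e′ ≡ (state S ⟨ e ≔ kindOf x (twist G e) ⟩) e′
  state-update S e x e′ with e′ ≟ e
  ... | yes refl = refl
  ... | no  _    = refl

  module _ (S : SubTr (ne G) 3) (e : Fin (ne G)) (S-e : S e ≡ nothing) (x : Fin 3) where

    private
      K : Kind
      K = kindOf x (twist G e)

      L′ = arcs (state S ⟨ e ≔ K ⟩)

      rank+comps-update : rank (S [ e ↦ x ]) + components L′ ≡ suc (rank S) + comps S
      rank+comps-update = begin
        rank (S [ e ↦ x ]) + components L′         ≡⟨ cong ((rank (S [ e ↦ x ]) +_) ∘ components) updated ⟨
        rank (S [ e ↦ x ]) + comps (S [ e ↦ x ])  ≡⟨ rank+comps (S [ e ↦ x ]) ⟩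
        size (S [ e ↦ x ]) + k₀                    ≡⟨ cong (_+ k₀) (size-update S e x S-e) ⟩
        suc (size S + k₀)                          ≡⟨ cong suc (rank+comps S) ⟨
        suc (rank S) + comps S                     ∎
        where
        open ≡-Reasoning
        updated : arcs (state (S [ e ↦ x ])) ≡ L′
        updated = arcs-cong (state-update S e x)

      bridging-here : components (bridge e K ∷ L′) ≡ comps S
      bridging-here = bridging-one (state S) e K (cong (Maybe.map _) S-e)

    rank-update-bridged : Bridged (state S) e K → rank (S [ e ↦ x ]) ≡ suc (rank S)
    rank-update-bridged bridged = +-cancelʳ-≡ (comps S) _ _
      (subst (λ c → rank (S [ e ↦ x ]) + c ≡ suc (rank S) + comps S)
             (trans (sym (components-∷-connected bridged)) bridging-here) rank+comps-update)

    rank-update-unbridged : ¬ Bridged (state S) e K → rank (S [ e ↦ x ]) ≡ rank S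
    rank-update-unbridged unbridged = +-cancelʳ-≡ (suc (comps S)) _ _
      (trans (subst (λ c → rank (S [ e ↦ x ]) + c ≡ suc (rank S) + comps S)
                    (trans (sym (components-∷-disconnected unbridged)) (cong suc bridging-here)) rank+comps-update)
             (sym (+-suc (rank S) (comps S))))

    rank-≤-update : rank S ≤ rank (S [ e ↦ x ])
    rank-≤-update with Conn? L′ (pt e origin) (pt e (far K))
    ... | yes bridged  = ≤-trans (n≤1+n _) (≤-reflexive (sym (rank-update-bridged bridged)))
    ... | no unbridged = ≤-reflexive (sym (rank-update-unbridged unbridged))

  complete : State → Fin (ne G) → State
  complete st e e′ = if does (e′ ≟ e) then nothing else just (fromMaybe deleted (st e′))

  ⊑-complete : ∀ st e K → (st ⟨ e ≔ K ⟩) ⊑ (complete st e ⟨ e ≔ K ⟩)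
  ⊑-complete st e K e′ with e′ ≟ e
  ... | yes _ = inj₂ refl
  ... | no  _ with st e′
  ... | nothing = inj₁ refl
  ... | just _  = inj₂ refl

  -- Assigning kinds to the other edges only removes connections, so a bridge closed after
  -- completing them was closed before.
  one-unbridged-choice : ∀ S e → S e ≡ nothing → ∃ λ x* → ∀ x → x ≢ x* → rank (S [ e ↦ x ]) ≡ suc (rank S)
  one-unbridged-choice S e S-e = choiceOf K* t , λ x x≢x* →
    rank-update-bridged S e S-e x ((arcs-⊑ (⊑-complete (state S) e _) ⋆)
      (bridged-unless-paired st⁺ e st⁺-e assigned (kindOf x t)
        (λ K≡K* → x≢x* (trans (sym (choiceOf-kindOf x t)) (cong (λ K → choiceOf K t) K≡K*)))))
    where
    t = twist G e
    st⁺ = complete (state S) e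
    st⁺-e : st⁺ e ≡ nothing
    st⁺-e rewrite dec-true (e ≟ e) refl = refl
    assigned : ∀ e′ → e′ ≢ e → ∃ λ K → st⁺ e′ ≡ just K
    assigned e′ e′≢e rewrite dec-false (e′ ≟ e) e′≢e = _ , refl
    K* = paired st⁺ e st⁺-e assigned

  skew-rank : ∀ S e x y → S e ≡ nothing → x ≢ y → 2 * rank S + 1 ≤ rank (S [ e ↦ x ]) + rank (S [ e ↦ y ])
  skew-rank S e x y S-e x≢y with one-unbridged-choice S e S-e
  ... | x* , up with x ≟ x*
  ... | no x≢x* = begin
    2 * rank S + 1                     ≡⟨ double+1 (rank S) ⟩
    suc (rank S) + rank S              ≤⟨ +-mono-≤ (≤-reflexive (sym (up x x≢x*))) (rank-≤-update S e S-e y) ⟩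
    rank (S [ e ↦ x ]) + rank (S [ e ↦ y ]) ∎
    where open ≤-Reasoning
  ... | yes refl = begin
    2 * rank S + 1                     ≡⟨ double+1 (rank S) ⟩
    suc (rank S) + rank S              ≡⟨ +-comm (suc (rank S)) (rank S) ⟩
    rank S + suc (rank S)              ≤⟨ +-mono-≤ (rank-≤-update S e S-e x) (≤-reflexive (sym (up y (x≢y ∘ sym)))) ⟩
    rank (S [ e ↦ x ]) + rank (S [ e ↦ y ]) ∎
    where open ≤-Reasoning

  tight-rank : ∀ S e → S e ≡ nothing → (∀ e′ → e′ ≢ e → ¬ S e′ ≡ nothing) → ∃ λ x → rank (S [ e ↦ x ]) ≡ rank S
  tight-rank S e S-e others = choiceOf K* t , rank-update-unbridged S e S-e (choiceOf K* t)
    (subst (¬_ ∘ Bridged (state S) e) (sym (kindOf-choiceOf K* t)) (paired-unbridged (state S) e st-e assigned))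
    where
    t = twist G e
    st-e : state S e ≡ nothing
    st-e = cong (Maybe.map _) S-e
    assigned : ∀ e′ → e′ ≢ e → ∃ λ K → state S e′ ≡ just K
    assigned e′ e′≢e with S e′ in S-e′
    ... | nothing = ⊥-elim (others e′ e′≢e S-e′)
    ... | just _  = _ , refl
    K* = paired (state S) e st-e assigned

boundaryKind : Bool → Bool → Kind
boundaryKind true  _     = deleted
boundaryKind false true  = twisted
boundaryKind false false = untwisted

kindOf-boundaryKind : ∀ x t → kindOf x t ≡ boundaryKind (does (x ≟ suc zero)) (t xor does (x ≟ suc (suc zero)))
kindOf-boundaryKind zero             true  = refl
kindOf-boundaryKind zero             false = refl
kindOf-boundaryKind (suc zero)       t     = refl
kindOf-boundaryKind (suc (suc zero)) true  = refl
kindOf-boundaryKind (suc (suc zero)) false = refl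

module Characterisation (G : RibbonGraph) where

  open Boundary G
  open Rank G

  k₀-components : HasComponents (CArc G) k₀
  k₀-components = label , onto , classes
    where
    f = proj₁ (components-spec (arcs unassigned))
    f-onto = proj₁ (proj₂ (components-spec (arcs unassigned)))
    f-classes = proj₂ (proj₂ (components-spec (arcs unassigned)))

    label : Dart (ne G) → Fin k₀
    label d = f (d , zero)

    sides : ∀ d s → Conn (arcs unassigned) (d , zero) (d , s)
    sides (e , i) s = arcs-merged unassigned e refl (i , zero) (i , s)

    onto : ∀ c → ∃ λ d → label d ≡ c
    onto c with f-onto c
    ... | (d , s) , fd≡c = d , trans (Equivalence.from (f-classes _ _) (sides d s)) fd≡c

    step : CArc G =[ label ]⇒ _≡_
    step (vtx d)  = Equivalence.from (f-classes _ _) (sides d (suc zero) ◅◅ arc (vertexArc∈arcs unassigned d))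
    step (edge e) =
      Equivalence.from (f-classes _ _) (arcs-merged unassigned e refl (zero , zero) (suc zero , zero))

    ends : ∀ e i i′ → EqClosure (CArc G) (e , i) (e , i′)
    ends e zero       zero       = ε
    ends e zero       (suc zero) = EC.return (edge e)
    ends e (suc zero) zero       = EC.symmetric _ (EC.return (edge e))
    ends e (suc zero) (suc zero) = ε

    project : Edge (arcs unassigned) =[ proj₁ ]⇒ EqClosure (CArc G)
    project q∈ with arcs-cases unassigned q∈
    ... | inj₁ (d , refl) = EC.return (vtx d)
    ... | inj₂ (e , q∈e) with edgeArcs-at {X = nothing} q∈e
    ... | refl , refl = ends e _ _

    classes : ∀ d d′ → (label d ≡ label d′) ⇔ EqClosure (CArc G) d d′
    classes d d′ = mk⇔ (EC.gfold (EC.isEquivalence (CArc G)) proj₁ project ∘ Equivalence.to (f-classes _ _))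
                       (EC.gfold isEquivalence label step)

  module _ (S : SubTr (ne G) 3) (p : Fin (ne G) → Fin 3) (S≗p : ∀ e → S e ≡ just (p e)) where

    private
      G′ = petrial G (blockZ p)
      Y = blockY p

      state-at : ∀ {e b t} → Y e ≡ b → twist G′ e ≡ t → state S e ≡ just (boundaryKind b t)
      state-at {e} refl refl rewrite S≗p e = cong just (kindOf-boundaryKind (p e) (twist G e))

      kindArc⇒BArc : ∀ e {u v} → (u , v) ∈ kindArcs e (boundaryKind (Y e) (twist G′ e)) → BArc G′ Y u v
      kindArc⇒BArc e q∈ with Y e in y | twist G′ e in t
      kindArc⇒BArc e (here refl)         | true  | _     = del e y zero
      kindArc⇒BArc e (there (here refl)) | true  | _     = del e y (suc zero)
      kindArc⇒BArc e (here refl)         | false | true  = tw e y t zero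
      kindArc⇒BArc e (there (here refl)) | false | true  = tw e y t (suc zero)
      kindArc⇒BArc e (here refl)         | false | false = untw e y t zero
      kindArc⇒BArc e (there (here refl)) | false | false = untw e y t (suc zero)

      arcs⇒BArc : Edge (arcs (state S)) ⇒ EqClosure (BArc G′ Y)
      arcs⇒BArc q∈ with arcs-cases (state S) q∈
      ... | inj₁ (d , refl) = EC.return (varc d)
      ... | inj₂ (e , q∈e) = EC.return (kindArc⇒BArc e (subst (λ X → _ ∈ edgeArcs e X) (state-at refl refl) q∈e))

      BArc⇒arcs : BArc G′ Y ⇒ Conn (arcs (state S))
      BArc⇒arcs (varc d)                = arc (vertexArc∈arcs _ d)
      BArc⇒arcs (untw e y t zero)       = arc (kindArc∈arcs _ (state-at y t) (here refl))
      BArc⇒arcs (untw e y t (suc zero)) = arc (kindArc∈arcs _ (state-at y t) (there (here refl)))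
      BArc⇒arcs (tw e y t zero)         = arc (kindArc∈arcs _ (state-at y t) (here refl))
      BArc⇒arcs (tw e y t (suc zero))   = arc (kindArc∈arcs _ (state-at y t) (there (here refl)))
      BArc⇒arcs (del e y zero)          = arc (kindArc∈arcs _ (state-at {t = twist G′ e} y refl) (here refl))
      BArc⇒arcs (del e y (suc zero))    = arc (kindArc∈arcs _ (state-at {t = twist G′ e} y refl) (there (here refl)))

    boundary-components : HasComponents (BArc G′ Y) (comps S)
    boundary-components = HasComponents-resp (components-spec _) arcs⇒BArc BArc⇒arcs

  M : Multimatroid (ne G) 3
  M = record { r = rank ; rank-on-transversals = rank-restrict-isMatroidRank ; skew = skew-rank }

  M-tight : Tight M
  M-tight = s≤s (s≤s z≤n) , tight-rank

  private
    update-here : ∀ (S : SubTr (ne G) 3) e x → (S [ e ↦ x ]) e ≡ just x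
    update-here S e x rewrite dec-true (e ≟ e) refl = refl

    ⊆-update : ∀ (S : SubTr (ne G) 3) e x → S e ≡ nothing → S ⊆ₛ (S [ e ↦ x ])
    ⊆-update S e x S-e e′ y S-e′ with e′ ≟ e
    ... | yes refl = contradiction (trans (sym S-e) S-e′) λ ()
    ... | no _     = S-e′

    another : ∀ (x : Fin 3) → ∃ λ y → y ≢ x
    another zero    = suc zero , λ ()
    another (suc _) = zero , λ ()

  -- A basis is a transversal: at a missing edge some choice raises the rank, contradicting maximality.
  basis-total : ∀ S → IsBasis M S → ∀ e → ∃ λ x → S e ≡ just x
  basis-total S (rank≡size , maximal) e with S e in S-e
  ... | just x  = x , refl
  ... | nothing with one-unbridged-choice S e S-e
  ... | x* , up with another x*
  ... | x , x≢x* with maximal (S [ e ↦ x ]) (⊆-update S e x S-e) independent e x (update-here S e x)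
    where
    independent : rank (S [ e ↦ x ]) ≡ size (S [ e ↦ x ])
    independent = trans (up x x≢x*) (trans (cong suc rank≡size) (sym (size-update S e x S-e)))
  ... | S-e≡x = contradiction (trans (sym S-e) S-e≡x) λ ()

  basis⇒Q : ∀ S → IsBasis M S → ∃ λ p → InQ G p × (∀ e → S e ≡ just (p e))
  basis⇒Q S basis = p , (nIso G + k₀ , (k₀ , boundary , refl) , (k₀ , k₀-components , refl)) , S≗p
    where
    p : Fin (ne G) → Fin 3
    p e = proj₁ (basis-total S basis e)
    S≗p : ∀ e → S e ≡ just (p e)
    S≗p e = proj₂ (basis-total S basis e)
    comps≡k₀ : comps S ≡ k₀
    comps≡k₀ = +-cancelˡ-≡ (size S) _ _ (trans (cong (_+ comps S) (sym (proj₁ basis))) (rank+comps S))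
    boundary : HasComponents (BArc (petrial G (blockZ p)) (blockY p)) k₀
    boundary = subst (HasComponents _) comps≡k₀ (boundary-components S p S≗p)

  Q⇒basis : ∀ S → (∃ λ p → InQ G p × (∀ e → S e ≡ just (p e))) → IsBasis M S
  Q⇒basis S (p , (m , (c , H , m≡c) , (c′ , H′ , m≡c′)) , S≗p) = rank≡size , maximal
    where
    comps≡k₀ : comps S ≡ k₀
    comps≡k₀ = trans (HasComponents-unique (boundary-components S p S≗p) H EC.return EC.return)
               (trans (+-cancelˡ-≡ (nIso G) _ _ (trans (sym m≡c) m≡c′))
                      (HasComponents-unique H′ k₀-components EC.return EC.return))
    rank≡size : rank S ≡ size S
    rank≡size = trans (cong (size S + k₀ ∸_) comps≡k₀) (m+n∸n≡m (size S) k₀)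
    maximal : ∀ S′ → S ⊆ₛ S′ → rank S′ ≡ size S′ → S′ ⊆ₛ S
    maximal S′ S⊆S′ _ e x S′-e =
      trans (S≗p e) (cong just (just-injective (trans (sym (S⊆S′ e (p e) (S≗p e))) S′-e)))

theorem6p3 : ∀ (G : RibbonGraph) →
    ∃ λ (M : Multimatroid (ne G) 3) →
      Tight M ×
      (∀ (S : SubTr (ne G) 3) →
        IsBasis M S ⇔ (∃ λ (p : Fin (ne G) → Fin 3) → InQ G p × (∀ e → S e ≡ just (p e))))
theorem6p3 G = M , M-tight , λ S → mk⇔ (basis⇒Q S) (Q⇒basis S)
  where open Characterisation G
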